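{- Let $n$ be a positive integer, $I$ the $n\times n$ identity matrix, $T=\mathrm{circ}(0,1,0,\ldots,0)$ the $n\times n$ cyclic shift matrix, and $A=4I-T-T^{ -1}$. Then $$\mathrm{coker}(I+A)\cong\mathbb{Z}_{\nu(n)}\oplus\mathbb{Z}_{3\mu(n)\nu(n)},$$ where $\mu(n)=1$ for $n$ odd and $\mu(n)=7$ for $n$ even.
   Context: For an integer $r\times r$ matrix $N$, $\mathrm{coker}(N)=\mathbb{Z}^r/N\mathbb{Z}^r$; $\mathbb{Z}_d$ is the cyclic group of order $d$ ($\mathbb{Z}_1$ trivial). $\mathrm{circ}(a_0,\ldots,a_{n-1})$ is the circulant matrix with first row $(a_0,\ldots,a_{n-1})$, each subsequent row being the previous one shifted cyclically to the right. Let $U_{m-1}(x)=\frac{\sin(m\arccos x)}{\sin(\arccos x)}$ be the Chebyshev polynomial of the second kind; at $x=5/2$ it equals $\frac{t^{m}-t^{ -m}}{t-t^{ -1}}$ with $t=\frac{5+\sqrt{21}}{2}$, $t^{1/2}=\frac{\sqrt7+\sqrt3}{2}$, which also defines it for half-integer $m$. Define $\nu(n)=\sqrt7\,U_{\frac n2-1}(\tfrac52)$ for $n$ odd and $\nu(n)=U_{\frac n2-1}(\tfrac52)$ for $n$ even; these are integers. -}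

module Defs where

open import Level using (0ℓ)
open import Data.Nat as ℕ using (ℕ; zero; suc)
open import Data.Nat.DivMod using (_%_; _/_)
open import Data.Fin using (Fin; toℕ)
open import Data.Integer using (ℤ; +_; _+_; _-_; _*_; -_)
open import Data.Integer.Divisibility using (_∣_)
open import Data.Product using (_×_; _,_; ∃)
open import Relation.Binary.PropositionalEquality using (_≡_)
open import Relation.Nullary.Decidable using (⌊_⌋)
open import Data.Bool using (if_then_else_)
open import Algebra.Bundles.Raw using (RawGroup)

Matrix : ℕ → Set
Matrix r = Fin r → Fin r → ℤ

Vector : ℕ → Set
Vector r = Fin r → ℤ

∑ : ∀ {r} → (Fin r → ℤ) → ℤ
∑ {zero}  f = + 0
∑ {suc r} f = f Fin.zero + ∑ {r} (λ i → f (Fin.suc i))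

_·_ : ∀ {r} → Matrix r → Vector r → Vector r
(N · z) i = ∑ (λ j → N i j * z j)

_⊕ₘ_ : ∀ {r} → Matrix r → Matrix r → Matrix r
(M ⊕ₘ N) i j = M i j + N i j

_⊖ₘ_ : ∀ {r} → Matrix r → Matrix r → Matrix r
(M ⊖ₘ N) i j = M i j - N i j

_⊛_ : ∀ {r} → ℤ → Matrix r → Matrix r
(c ⊛ N) i j = c * N i j

I : ∀ {r} → Matrix r
I i j = if ⌊ toℕ i ℕ.≟ toℕ j ⌋ then + 1 else + 0

T : ∀ n → .{{_ : ℕ.NonZero n}} → Matrix n
T n i j = if ⌊ toℕ j ℕ.≟ (suc (toℕ i)) % n ⌋ then + 1 else + 0

-- its inverse T⁻¹ (a permutation matrix, so T⁻¹ = Tᵀ):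
-- row i has its single 1 in column (i-1) mod n
T⁻¹ : ∀ n → .{{_ : ℕ.NonZero n}} → Matrix n
T⁻¹ n i j = T n j i

A : ∀ n → .{{_ : ℕ.NonZero n}} → Matrix n
A n = (((+ 4) ⊛ I) ⊖ₘ T n) ⊖ₘ T⁻¹ n

-- abelian groups presented without quotient types: a carrier with an
-- equivalence (the quotient relation) and the group operations

coker : ∀ {r} → Matrix r → RawGroup 0ℓ 0ℓ
coker {r} N = record
  { Carrier = Vector r
  ; _≈_     = λ x y → ∃ λ (z : Vector r) → ∀ i → x i - y i ≡ (N · z) i
  ; _∙_     = λ x y i → x i + y i
  ; ε       = λ _ → + 0
  ; _⁻¹     = λ x i → - x i
  }

ℤ/_⊕ℤ/_ : ℤ → ℤ → RawGroup 0ℓ 0ℓ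
ℤ/ d ⊕ℤ/ e = record
  { Carrier = ℤ × ℤ
  ; _≈_     = λ { (a , b) (a′ , b′) → (d ∣ (a - a′)) × (e ∣ (b - b′)) }
  ; _∙_     = λ { (a , b) (a′ , b′) → (a + a′ , b + b′) }
  ; ε       = (+ 0 , + 0)
  ; _⁻¹     = λ { (a , b) → (- a , - b) }
  }

-- group isomorphism G ≅ H (on the quotients): a map of representatives
-- that is a well-defined homomorphism, injective and surjective
-- modulo the respective equivalences
_≅_ : RawGroup 0ℓ 0ℓ → RawGroup 0ℓ 0ℓ → Set
G ≅ H = ∃ λ (f : RawGroup.Carrier G → RawGroup.Carrier H) →
          GroupMorphisms.IsGroupIsomorphism G H f
  where open import Algebra.Morphism.Structures using (module GroupMorphisms)

-- Chebyshev U at x = 5/2:  u k = U_{k-1}(5/2)  (U_{-1} = 0, U_0 = 1,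
-- U_{m+1} = 5 U_m - U_{m-1})
u : ℕ → ℤ
u zero = + 0
u (suc zero) = + 1
u (suc (suc k)) = + 5 * u (suc k) - u k

-- ν(2k) = U_{k-1}(5/2);  ν(2k+1) = √7 U_{k-1/2}(5/2) = U_k(5/2) + U_{k-1}(5/2)
ν : ℕ → ℤ
ν n with n % 2 | n / 2
... | zero  | k = u k
... | suc _ | k = u (suc k) + u k

μ : ℕ → ℕ
μ n with n % 2
... | zero  = 7
... | suc _ = 1

-- M = I + A = 5I − T − T⁻¹ has columns 5δₖ − δₖ₋₁ − δₖ₊₁ (indices mod n). For n ≥ 2 they let
-- one rewrite every δₖ modulo the image as w₀(k)·δ₀ + u(k)·δ₁, where u(k) = U_{k−1}(5/2) and w₀
-- solve xₖ₊₂ = 5xₖ₊₁ − xₖ with initial values (0, 1) and (1, 0). So coker M is ℤ² modulo the two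
-- wrap-around relations, the rows of [[5 + u(n−2), −1 − u(n−1)], [−1 − u(n−1), u(n)]]. By the
-- doubling formulas and Cassini's identity u(j)² − 5u(j)u(j+1) + u(j+1)² = 1 this matrix is
-- ν(n)·P with det P = 21 for n even and 3 for n odd, and P has Smith form diag(1, det P). The
-- isomorphism is x ↦ (⟨x, u⟩, ⟨x, w₀ + c·u⟩) for a suitable c; n = 1 is the 1 × 1 matrix (3).

module Submission where

open import Defs
open import Data.Nat as ℕ using (ℕ; zero; suc; NonZero; _<_; s≤s; z≤n)
import Data.Nat.Properties as ℕP
open import Data.Nat.DivMod using (_%_; m%n<n; n%n≡0; m<n⇒m%n≡m; m*n%n≡0; m*n/n≡m; [m+kn]%n≡m%n; +-distrib-/-∣ʳ)
import Data.Nat.Divisibility as ℕ∣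
open import Data.Integer as ℤ using (ℤ; +_; -[1+_]; 0ℤ; -_; _+_; _-_; _*_)
import Data.Integer.Properties as ℤP
open import Data.Integer.Divisibility.Signed
  using (_∣_; divides; ∣m∣n⇒∣m+n; ∣n⇒∣m*n; ∣⇒∣ᵤ; ∣ᵤ⇒∣)
open import Data.Integer.Tactic.RingSolver using (solve-∀; solve)
open import Data.Fin using (Fin; toℕ; fromℕ<) renaming (zero to fzero; suc to fsuc)
import Data.Fin.Properties as FinP
open import Data.Bool using (if_then_else_)
open import Data.List using ([]; _∷_)
open import Data.Product using (∃; _×_; _,_; proj₁; proj₂)
open import Data.Sum using (_⊎_; inj₁; inj₂)
open import Data.Empty using (⊥-elim)
open import Algebra.Bundles.Raw using (RawGroup)
open import Function using (_∘_)
open import Relation.Nullary.Decidable using (⌊_⌋; does-⇔; isYes≗does)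
open import Function.Bundles using (_⇔_; mk⇔)
open import Relation.Nullary using (does)
open import Relation.Binary.PropositionalEquality
open ≡-Reasoning

open import Algebra.Properties.Semiring.Sum ℤP.+-*-semiring
  using (sum; ∑-distrib-+; ∑-comm; *-distribˡ-sum; *-distribʳ-sum; sum-cong-≗; sum-replicate-zero)

∑≡sum : ∀ {r} (f : Vector r) → ∑ f ≡ sum f
∑≡sum {zero}  f = refl
∑≡sum {suc r} f = cong (_+_ (f fzero)) (∑≡sum (f ∘ fsuc))

∑-cong : ∀ {r} {f g : Vector r} → (∀ i → f i ≡ g i) → ∑ f ≡ ∑ g
∑-cong {f = f} {g} f≗g = trans (∑≡sum f) (trans (sum-cong-≗ f≗g) (sym (∑≡sum g)))

∑-zero : ∀ r → ∑ {r} (λ _ → 0ℤ) ≡ 0ℤ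
∑-zero r = trans (∑≡sum {r} (λ _ → 0ℤ)) (sum-replicate-zero r)

∑-+ : ∀ {r} (f g : Vector r) → ∑ (λ i → f i + g i) ≡ ∑ f + ∑ g
∑-+ f g = trans (∑≡sum (λ i → f i + g i)) (trans (∑-distrib-+ f g) (sym (cong₂ _+_ (∑≡sum f) (∑≡sum g))))

∑-*ˡ : ∀ {r} c (f : Vector r) → ∑ (λ i → c * f i) ≡ c * ∑ f
∑-*ˡ c f = trans (∑≡sum (λ i → c * f i)) (sym (trans (cong (c *_) (∑≡sum f)) (*-distribˡ-sum c f)))

∑-*ʳ : ∀ {r} c (f : Vector r) → ∑ (λ i → f i * c) ≡ ∑ f * c
∑-*ʳ c f = trans (∑≡sum (λ i → f i * c)) (sym (trans (cong (_* c) (∑≡sum f)) (*-distribʳ-sum c f)))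

∑-swap : ∀ {r s} (f : Fin r → Fin s → ℤ) →
         ∑ (λ i → ∑ (λ j → f i j)) ≡ ∑ (λ j → ∑ (λ i → f i j))
∑-swap f = begin
  ∑ (λ i → ∑ (f i))              ≡⟨ ∑-cong (λ i → ∑≡sum (f i)) ⟩
  ∑ (λ i → sum (f i))            ≡⟨ ∑≡sum (λ i → sum (f i)) ⟩
  sum (λ i → sum (f i))          ≡⟨ ∑-comm f ⟩
  sum (λ j → sum (λ i → f i j))  ≡⟨ ∑≡sum (λ j → sum (λ i → f i j)) ⟨
  ∑ (λ j → sum (λ i → f i j))    ≡⟨ ∑-cong (λ j → ∑≡sum (λ i → f i j)) ⟨
  ∑ (λ j → ∑ (λ i → f i j))      ∎

∣0 : ∀ d → d ∣ 0ℤ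
∣0 d = divides 0ℤ (sym (ℤP.*-zeroˡ d))

1∣ : ∀ t → + 1 ∣ t
1∣ t = divides t (sym (ℤP.*-identityʳ t))

i≡j⇒d∣i-j : ∀ d {i j} → i ≡ j → d ∣ i - j
i≡j⇒d∣i-j d i≡j = subst (d ∣_) (sym (ℤP.i≡j⇒i-j≡0 i≡j)) (∣0 d)

∣-∑ : ∀ {r} {d} (f : Vector r) → (∀ i → d ∣ f i) → d ∣ ∑ f
∣-∑ {zero}  {d} f d∣f = ∣0 d
∣-∑ {suc r}     f d∣f = ∣m∣n⇒∣m+n (d∣f fzero) (∣-∑ (f ∘ fsuc) (d∣f ∘ fsuc))

infixl 6 _+ᵥ_ _-ᵥ_
infixl 7 _*ᵥ_
infix  8 -ᵥ_

_+ᵥ_ : ∀ {r} → Vector r → Vector r → Vector r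
(x +ᵥ y) i = x i + y i

-ᵥ_ : ∀ {r} → Vector r → Vector r
(-ᵥ x) i = - x i

_-ᵥ_ : ∀ {r} → Vector r → Vector r → Vector r
x -ᵥ y = x +ᵥ (-ᵥ y)

_*ᵥ_ : ∀ {r} → ℤ → Vector r → Vector r
(c *ᵥ x) i = c * x i

0ᵥ : ∀ {r} → Vector r
0ᵥ _ = 0ℤ

-- δ k is the zero vector when k ≥ r; I i j is definitionally δ (toℕ j) i.
δ : ∀ {r} → ℕ → Vector r
δ k i = if ⌊ toℕ i ℕ.≟ k ⌋ then + 1 else + 0

δ-⇔ : ∀ {r s} {i : Fin r} {j : Fin s} {k l} → (toℕ i ≡ k ⇔ toℕ j ≡ l) → δ k i ≡ δ l j
δ-⇔ {i = i} {j} {k} {l} i≡k⇔j≡l =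
  cong (λ b → if b then + 1 else + 0) (begin
    ⌊ toℕ i ℕ.≟ k ⌋   ≡⟨ isYes≗does (toℕ i ℕ.≟ k) ⟩
    does (toℕ i ℕ.≟ k) ≡⟨ does-⇔ i≡k⇔j≡l (toℕ i ℕ.≟ k) (toℕ j ℕ.≟ l) ⟩
    does (toℕ j ℕ.≟ l) ≡⟨ isYes≗does (toℕ j ℕ.≟ l) ⟨
    ⌊ toℕ j ℕ.≟ l ⌋   ∎)

δ-suc : ∀ {r} k (i : Fin r) → δ {suc r} (suc k) (fsuc i) ≡ δ k i
δ-suc k i = δ-⇔ (mk⇔ ℕP.suc-injective (cong suc))

δ-sym : ∀ {r} (i j : Fin r) → δ (toℕ j) i ≡ δ (toℕ i) j
δ-sym i j = δ-⇔ (mk⇔ sym sym)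

∑-δ : ∀ {r} (j : Fin r) (g : Vector r) → ∑ (λ k → δ (toℕ j) k * g k) ≡ g j
∑-δ {suc r} fzero g = begin
  + 1 * g fzero + ∑ (λ k → 0ℤ * g (fsuc k))  ≡⟨ cong₂ _+_ (ℤP.*-identityˡ (g fzero)) (∑-zero r) ⟩
  g fzero + 0ℤ                               ≡⟨ ℤP.+-identityʳ (g fzero) ⟩
  g fzero                                    ∎
∑-δ {suc r} (fsuc j) g = begin
  0ℤ * g fzero + ∑ (λ k → δ (suc (toℕ j)) (fsuc k) * g (fsuc k))
    ≡⟨ cong (_+_ 0ℤ) (∑-cong (λ k → cong (_* g (fsuc k)) (δ-suc (toℕ j) k))) ⟩
  0ℤ + ∑ (λ k → δ (toℕ j) k * g (fsuc k))   ≡⟨ ℤP.+-identityˡ _ ⟩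
  ∑ (λ k → δ (toℕ j) k * g (fsuc k))        ≡⟨ ∑-δ j (g ∘ fsuc) ⟩
  g (fsuc j)                                ∎

∑-δ-expand : ∀ {r} (x : Vector r) i → ∑ (λ k → x k * δ (toℕ k) i) ≡ x i
∑-δ-expand x i = trans (∑-cong (λ k → trans (ℤP.*-comm (x k) _) (cong (_* x k) (δ-sym i k)))) (∑-δ i x)

⟨_,_⟩ : ∀ {r} → Vector r → Vector r → ℤ
⟨ x , y ⟩ = ∑ (λ i → x i * y i)

⟨⟩-cong : ∀ {r} {x y : Vector r} (φ : Vector r) → (∀ i → x i ≡ y i) → ⟨ x , φ ⟩ ≡ ⟨ y , φ ⟩
⟨⟩-cong φ x≗y = ∑-cong (λ i → cong (_* φ i) (x≗y i))

⟨+ᵥ⟩ : ∀ {r} (x y φ : Vector r) → ⟨ x +ᵥ y , φ ⟩ ≡ ⟨ x , φ ⟩ + ⟨ y , φ ⟩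
⟨+ᵥ⟩ x y φ = trans (∑-cong (λ i → ℤP.*-distribʳ-+ (φ i) (x i) (y i))) (∑-+ (λ i → x i * φ i) (λ i → y i * φ i))

⟨*ᵥ⟩ : ∀ {r} c (x φ : Vector r) → ⟨ c *ᵥ x , φ ⟩ ≡ c * ⟨ x , φ ⟩
⟨*ᵥ⟩ c x φ = trans (∑-cong (λ i → ℤP.*-assoc c (x i) (φ i))) (∑-*ˡ c (λ i → x i * φ i))

⟨-ᵥx⟩ : ∀ {r} (x φ : Vector r) → ⟨ -ᵥ x , φ ⟩ ≡ - ⟨ x , φ ⟩
⟨-ᵥx⟩ x φ = begin
  ⟨ -ᵥ x , φ ⟩            ≡⟨ ⟨⟩-cong φ (λ i → ℤP.-1*i≡-i (x i)) ⟨
  ⟨ -[1+ 0 ] *ᵥ x , φ ⟩   ≡⟨ ⟨*ᵥ⟩ -[1+ 0 ] x φ ⟩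
  -[1+ 0 ] * ⟨ x , φ ⟩    ≡⟨ ℤP.-1*i≡-i _ ⟩
  - ⟨ x , φ ⟩             ∎

⟨x-ᵥy⟩ : ∀ {r} (x y φ : Vector r) → ⟨ x -ᵥ y , φ ⟩ ≡ ⟨ x , φ ⟩ - ⟨ y , φ ⟩
⟨x-ᵥy⟩ x y φ = trans (⟨+ᵥ⟩ x (-ᵥ y) φ) (cong (_+_ ⟨ x , φ ⟩) (⟨-ᵥx⟩ y φ))

⟨0ᵥ⟩ : ∀ {r} (φ : Vector r) → ⟨ 0ᵥ , φ ⟩ ≡ 0ℤ
⟨0ᵥ⟩ {r} φ = ∑-zero r

⟨δ⟩ : ∀ {r} k → k < r → (φ : ℕ → ℤ) → ⟨ δ {r} k , φ ∘ toℕ ⟩ ≡ φ k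
⟨δ⟩ {r} k k<r φ = begin
  ⟨ δ k , φ′ ⟩        ≡⟨ ⟨⟩-cong φ′ (λ i → δ-⇔ {i = i} {j = i} (mk⇔ (λ i≡k → trans i≡k (sym j≡k))
                                                                   (λ i≡j → trans i≡j j≡k))) ⟩
  ⟨ δ (toℕ j) , φ′ ⟩  ≡⟨ ∑-δ j φ′ ⟩
  φ (toℕ j)           ≡⟨ cong φ j≡k ⟩
  φ k                 ∎
  where
  φ′ : Vector r
  φ′ = φ ∘ toℕ
  j : Fin r
  j = fromℕ< k<r
  j≡k : toℕ j ≡ k
  j≡k = FinP.toℕ-fromℕ< k<r

⟨⟩-comm : ∀ {r} (x y : Vector r) → ⟨ x , y ⟩ ≡ ⟨ y , x ⟩
⟨⟩-comm x y = ∑-cong (λ i → ℤP.*-comm (x i) (y i))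

combination : ∀ {r s} → (Fin s → ℤ) → (Fin s → Vector r) → Vector r
combination c Z i = ∑ (λ k → c k * Z k i)

⟨combination⟩ : ∀ {r s} (c : Fin s → ℤ) (Z : Fin s → Vector r) (φ : Vector r) →
                ⟨ combination c Z , φ ⟩ ≡ ∑ (λ k → c k * ⟨ Z k , φ ⟩)
⟨combination⟩ c Z φ = begin
  ∑ (λ i → ∑ (λ k → c k * Z k i) * φ i)    ≡⟨ ∑-cong (λ i → ∑-*ʳ (φ i) (λ k → c k * Z k i)) ⟨
  ∑ (λ i → ∑ (λ k → c k * Z k i * φ i))    ≡⟨ ∑-swap (λ i k → c k * Z k i * φ i) ⟩
  ∑ (λ k → ∑ (λ i → c k * Z k i * φ i))    ≡⟨ ∑-cong (λ k → ∑-cong (λ i → ℤP.*-assoc (c k) (Z k i) (φ i))) ⟩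
  ∑ (λ k → ∑ (λ i → c k * (Z k i * φ i)))  ≡⟨ ∑-cong (λ k → ∑-*ˡ (c k) (λ i → Z k i * φ i)) ⟩
  ∑ (λ k → c k * ⟨ Z k , φ ⟩)              ∎

column : ∀ {r} → Matrix r → Fin r → Vector r
column N j i = N i j

·-columns : ∀ {r} (N : Matrix r) (z : Vector r) i → (N · z) i ≡ combination z (column N) i
·-columns N z i = ∑-cong (λ j → ℤP.*-comm (N i j) (z j))

⟨·⟩ : ∀ {r} (N : Matrix r) (z φ : Vector r) → ⟨ N · z , φ ⟩ ≡ ∑ (λ j → z j * ⟨ column N j , φ ⟩)
⟨·⟩ N z φ = trans (⟨⟩-cong φ (·-columns N z)) (⟨combination⟩ z (column N) φ)

·-+ᵥ : ∀ {r} (N : Matrix r) (z z′ : Vector r) i → (N · (z +ᵥ z′)) i ≡ (N · z) i + (N · z′) i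
·-+ᵥ N z z′ i = begin
  ⟨ N i , z +ᵥ z′ ⟩             ≡⟨ ⟨⟩-comm (N i) _ ⟩
  ⟨ z +ᵥ z′ , N i ⟩             ≡⟨ ⟨+ᵥ⟩ z z′ (N i) ⟩
  ⟨ z , N i ⟩ + ⟨ z′ , N i ⟩    ≡⟨ cong₂ _+_ (⟨⟩-comm z (N i)) (⟨⟩-comm z′ (N i)) ⟩
  ⟨ N i , z ⟩ + ⟨ N i , z′ ⟩    ∎

·-*ᵥ : ∀ {r} (N : Matrix r) c (z : Vector r) i → (N · (c *ᵥ z)) i ≡ c * (N · z) i
·-*ᵥ N c z i = trans (⟨⟩-comm (N i) _) (trans (⟨*ᵥ⟩ c z (N i)) (cong (c *_) (⟨⟩-comm z (N i))))

·-combination : ∀ {r s} (N : Matrix r) (c : Fin s → ℤ) (Z : Fin s → Vector r) i →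
                (N · combination c Z) i ≡ combination c (λ k → N · Z k) i
·-combination N c Z i = begin
  ⟨ N i , combination c Z ⟩            ≡⟨ ⟨⟩-comm (N i) _ ⟩
  ⟨ combination c Z , N i ⟩            ≡⟨ ⟨combination⟩ c Z (N i) ⟩
  ∑ (λ k → c k * ⟨ Z k , N i ⟩)        ≡⟨ ∑-cong (λ k → cong (c k *_) (⟨⟩-comm (Z k) (N i))) ⟩
  ∑ (λ k → c k * ⟨ N i , Z k ⟩)        ∎

_∈Im_ : ∀ {r} → Vector r → Matrix r → Set
w ∈Im N = ∃ λ z → ∀ i → w i ≡ (N · z) i

module Image {r} (N : Matrix r) where

  ∈Im-resp : ∀ {w w′} → (∀ i → w′ i ≡ w i) → w ∈Im N → w′ ∈Im N
  ∈Im-resp w′≗w (z , w≗Nz) = z , λ i → trans (w′≗w i) (w≗Nz i)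

  0ᵥ∈Im : 0ᵥ ∈Im N
  0ᵥ∈Im = 0ᵥ , λ i → sym (trans (∑-cong (λ j → ℤP.*-zeroʳ (N i j))) (∑-zero r))

  ∈Im-+ᵥ : ∀ {w w′} → w ∈Im N → w′ ∈Im N → (w +ᵥ w′) ∈Im N
  ∈Im-+ᵥ (z , w≗Nz) (z′ , w′≗Nz′) =
    z +ᵥ z′ , λ i → trans (cong₂ _+_ (w≗Nz i) (w′≗Nz′ i)) (sym (·-+ᵥ N z z′ i))

  ∈Im-*ᵥ : ∀ c {w} → w ∈Im N → (c *ᵥ w) ∈Im N
  ∈Im-*ᵥ c (z , w≗Nz) = c *ᵥ z , λ i → trans (cong (c *_) (w≗Nz i)) (sym (·-*ᵥ N c z i))

  ∈Im-subᵥ : ∀ {w w′} → w ∈Im N → w′ ∈Im N → (w -ᵥ w′) ∈Im N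
  ∈Im-subᵥ {w} {w′} w∈ w′∈ =
    ∈Im-resp (λ i → cong (_+_ (w i)) (sym (ℤP.-1*i≡-i (w′ i)))) (∈Im-+ᵥ w∈ (∈Im-*ᵥ -[1+ 0 ] w′∈))

  ∈Im-combination : ∀ {s} (c : Fin s → ℤ) {Z : Fin s → Vector r} →
                    (∀ k → Z k ∈Im N) → combination c Z ∈Im N
  ∈Im-combination c {Z} Z∈ =
    combination c (proj₁ ∘ Z∈) ,
    λ i → trans (∑-cong (λ k → cong (c k *_) (proj₂ (Z∈ k) i))) (sym (·-combination N c (proj₁ ∘ Z∈) i))

  column∈Im : ∀ j → column N j ∈Im N
  column∈Im j = δ (toℕ j) , λ i → sym (trans (⟨⟩-comm (N i) _) (∑-δ j (N i)))

coker≅ℤ/⊕ℤ/ : ∀ {r} (N : Matrix r) {d e : ℤ} (φ ψ : Vector r) →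
  (∀ z → d ∣ ⟨ N · z , φ ⟩ × e ∣ ⟨ N · z , ψ ⟩) →
  (∀ p q → ∃ λ x → d ∣ ⟨ x , φ ⟩ - p × e ∣ ⟨ x , ψ ⟩ - q) →
  (∀ x → d ∣ ⟨ x , φ ⟩ → e ∣ ⟨ x , ψ ⟩ → x ∈Im N) →
  coker N ≅ (ℤ/ d ⊕ℤ/ e)
coker≅ℤ/⊕ℤ/ N {d} {e} φ ψ Im⇒∣ onto ∣⇒Im = F , record
  { isGroupMonomorphism = record
    { isGroupHomomorphism = record
      { isMonoidHomomorphism = record
        { isMagmaHomomorphism = record
          { isRelHomomorphism = record
            { cong = λ {x} {y} x-y∈Im → let (d∣ , e∣) = ∣-difference x y x-y∈Im in ∣⇒∣ᵤ d∣ , ∣⇒∣ᵤ e∣ }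
          ; homo = λ x y → F-exact (⟨+ᵥ⟩ x y φ) (⟨+ᵥ⟩ x y ψ)
          }
        ; ε-homo = F-exact (⟨0ᵥ⟩ φ) (⟨0ᵥ⟩ ψ)
        }
      ; ⁻¹-homo = λ x → F-exact (⟨-ᵥx⟩ x φ) (⟨-ᵥx⟩ x ψ)
      }
    ; injective = λ {x} {y} (d∣ , e∣) → ∣⇒Im (x -ᵥ y)
        (subst (d ∣_) (sym (⟨x-ᵥy⟩ x y φ)) (∣ᵤ⇒∣ d∣))
        (subst (e ∣_) (sym (⟨x-ᵥy⟩ x y ψ)) (∣ᵤ⇒∣ e∣))
    }
  ; surjective = λ (p , q) → let (x , d∣ , e∣) = onto p q in x , λ {z} z-x∈Im →
      let (d∣′ , e∣′) = ∣-difference z x z-x∈Im in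
      ∣⇒∣ᵤ (subst (d ∣_) (ℤP.+-minus-telescope ⟨ z , φ ⟩ ⟨ x , φ ⟩ p) (∣m∣n⇒∣m+n d∣′ d∣)) ,
      ∣⇒∣ᵤ (subst (e ∣_) (ℤP.+-minus-telescope ⟨ z , ψ ⟩ ⟨ x , ψ ⟩ q) (∣m∣n⇒∣m+n e∣′ e∣))
  }
  where
  F : Vector _ → ℤ × ℤ
  F x = ⟨ x , φ ⟩ , ⟨ x , ψ ⟩

  F-exact : ∀ {a b a′ b′} → a ≡ a′ → b ≡ b′ →
            RawGroup._≈_ (ℤ/ d ⊕ℤ/ e) (a , b) (a′ , b′)
  F-exact a≡a′ b≡b′ = ∣⇒∣ᵤ (i≡j⇒d∣i-j d a≡a′) , ∣⇒∣ᵤ (i≡j⇒d∣i-j e b≡b′)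

  ∣-difference : ∀ x y → (x -ᵥ y) ∈Im N → d ∣ ⟨ x , φ ⟩ - ⟨ y , φ ⟩ × e ∣ ⟨ x , ψ ⟩ - ⟨ y , ψ ⟩
  ∣-difference x y (z , x-y≗Nz) =
    subst (d ∣_) (trans (sym (⟨⟩-cong φ x-y≗Nz)) (⟨x-ᵥy⟩ x y φ)) (proj₁ (Im⇒∣ z)) ,
    subst (e ∣_) (trans (sym (⟨⟩-cong ψ x-y≗Nz)) (⟨x-ᵥy⟩ x y ψ)) (proj₂ (Im⇒∣ z))

coker-n≡1 : coker (I ⊕ₘ A 1) ≅ (ℤ/ (+ 1) ⊕ℤ/ (+ 3))
coker-n≡1 = coker≅ℤ/⊕ℤ/ (I ⊕ₘ A 1) 0ᵥ 1ᵥ Im⇒∣ onto ∣⇒Im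
  where
  1ᵥ : Vector 1
  1ᵥ _ = + 1

  M·z≡3z : ∀ z → ((I ⊕ₘ A 1) · z) fzero ≡ z fzero * + 3
  M·z≡3z z = times-three (z fzero)
    where
    times-three : ∀ a → + 3 * a + 0ℤ ≡ a * + 3
    times-three = solve-∀

  ⟨x,1ᵥ⟩≡x₀ : ∀ x → ⟨ x , 1ᵥ ⟩ ≡ x fzero
  ⟨x,1ᵥ⟩≡x₀ x = trans (ℤP.+-identityʳ _) (ℤP.*-identityʳ (x fzero))

  Im⇒∣ : ∀ z → + 1 ∣ ⟨ (I ⊕ₘ A 1) · z , 0ᵥ ⟩ × + 3 ∣ ⟨ (I ⊕ₘ A 1) · z , 1ᵥ ⟩
  Im⇒∣ z = 1∣ _ , divides (z fzero) (trans (⟨x,1ᵥ⟩≡x₀ ((I ⊕ₘ A 1) · z)) (M·z≡3z z))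

  onto : ∀ p q → ∃ λ x → + 1 ∣ ⟨ x , 0ᵥ ⟩ - p × + 3 ∣ ⟨ x , 1ᵥ ⟩ - q
  onto p q = (λ _ → q) , 1∣ _ , i≡j⇒d∣i-j (+ 3) (⟨x,1ᵥ⟩≡x₀ (λ _ → q))

  ∣⇒Im : ∀ x → + 1 ∣ ⟨ x , 0ᵥ ⟩ → + 3 ∣ ⟨ x , 1ᵥ ⟩ → x ∈Im (I ⊕ₘ A 1)
  ∣⇒Im x _ (divides t ⟨x,1⟩≡t*3) =
    (λ _ → t) , λ { fzero → trans (sym (⟨x,1ᵥ⟩≡x₀ x)) (trans ⟨x,1⟩≡t*3 (sym (M·z≡3z (λ _ → t)))) }

-- The coefficients come from P⁻¹ = adj P / k for P = [[p, q], [q, s]].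
span-of-rows : ∀ {d k c α β p q s : ℤ} .{{_ : ℤ.NonZero k}} →
  p * s - q * q ≡ k → p + c * q ≡ k * α → q + c * s ≡ k * β →
  ∀ {A B t₁ t₂} → B ≡ t₁ * d → A + c * B ≡ t₂ * (d * k) →
  ∃ λ c₀ → ∃ λ c₁ → A ≡ c₀ * (d * p) + c₁ * (d * q) × B ≡ c₀ * (d * q) + c₁ * (d * s)
span-of-rows {d} {k} {c} {α} {β} {p} {q} {s} det kα kβ {A} {B} {t₁} {t₂} B≡ A+cB≡ =
  t₂ * s - t₁ * β , t₁ * α - t₂ * q ,
  (begin
    A                                              ≡⟨ solve (A ∷ B ∷ c ∷ []) ⟩
    (A + c * B) - c * B                            ≡⟨ cong₂ (λ x y → x - c * y) A+cB≡ B≡ ⟩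
    t₂ * (d * k) - c * (t₁ * d)                    ≡⟨ solve (t₁ ∷ t₂ ∷ c ∷ d ∷ k ∷ []) ⟩
    d * (t₂ * k + t₁ * (- c))                      ≡⟨ cong₂ (λ x y → d * (t₂ * x + t₁ * y)) det αq-βp≡-c ⟨
    d * (t₂ * (p * s - q * q) + t₁ * (α * q - β * p))
      ≡⟨ solve (t₁ ∷ t₂ ∷ d ∷ α ∷ β ∷ p ∷ q ∷ s ∷ []) ⟩
    (t₂ * s - t₁ * β) * (d * p) + (t₁ * α - t₂ * q) * (d * q) ∎) ,
  (begin
    B                            ≡⟨ B≡ ⟩
    t₁ * d                       ≡⟨ solve (t₁ ∷ d ∷ []) ⟩
    d * (t₁ * + 1)               ≡⟨ cong (λ x → d * (t₁ * x)) αs-βq≡1 ⟨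
    d * (t₁ * (α * s - β * q))   ≡⟨ solve (t₁ ∷ t₂ ∷ d ∷ α ∷ β ∷ q ∷ s ∷ []) ⟩
    (t₂ * s - t₁ * β) * (d * q) + (t₁ * α - t₂ * q) * (d * s) ∎)
  where
  αs-βq≡1 : α * s - β * q ≡ + 1
  αs-βq≡1 = ℤP.*-cancelˡ-≡ k _ _ (begin
    k * (α * s - β * q)                ≡⟨ solve (k ∷ α ∷ β ∷ q ∷ s ∷ []) ⟩
    (k * α) * s - (k * β) * q          ≡⟨ cong₂ (λ x y → x * s - y * q) kα kβ ⟨
    (p + c * q) * s - (q + c * s) * q  ≡⟨ solve (c ∷ p ∷ q ∷ s ∷ []) ⟩
    p * s - q * q                      ≡⟨ det ⟩
    k                                  ≡⟨ ℤP.*-identityʳ k ⟨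
    k * + 1                            ∎)

  αq-βp≡-c : α * q - β * p ≡ - c
  αq-βp≡-c = ℤP.*-cancelˡ-≡ k _ _ (begin
    k * (α * q - β * p)                ≡⟨ solve (k ∷ α ∷ β ∷ p ∷ q ∷ []) ⟩
    (k * α) * q - (k * β) * p          ≡⟨ cong₂ (λ x y → x * q - y * p) kα kβ ⟨
    (p + c * q) * q - (q + c * s) * p  ≡⟨ solve (c ∷ p ∷ q ∷ s ∷ []) ⟩
    (p * s - q * q) * (- c)            ≡⟨ cong (_* (- c)) det ⟩
    k * (- c)                          ∎)

Recurrent : (ℕ → ℤ) → Set
Recurrent φ = ∀ k → φ (suc (suc k)) ≡ + 5 * φ (suc k) - φ k

u-recurrent : Recurrent u
u-recurrent k = refl

w₀ : ℕ → ℤ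
w₀ zero                = + 1
w₀ (suc zero)          = 0ℤ
w₀ (suc (suc k))       = + 5 * w₀ (suc k) - w₀ k

w₀-suc : ∀ k → w₀ (suc k) ≡ - u k
w₀-suc zero          = refl
w₀-suc (suc zero)    = refl
w₀-suc (suc (suc k)) = begin
  + 5 * w₀ (suc (suc k)) - w₀ (suc k) ≡⟨ cong₂ (λ x y → + 5 * x - y) (w₀-suc (suc k)) (w₀-suc k) ⟩
  + 5 * (- u (suc k)) - (- u k)       ≡⟨ negate (u (suc k)) (u k) ⟩
  - u (suc (suc k))                   ∎
  where
  negate : ∀ x y → + 5 * (- x) - (- y) ≡ - (+ 5 * x - y)
  negate = solve-∀

module Cyclic (n′ : ℕ) where

  n : ℕ
  n = suc n′

  prev next : ℕ → ℕ
  prev zero    = n′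
  prev (suc k) = k
  next k = suc k % n

  prev<n : ∀ {k} → k < n → prev k < n
  prev<n {zero}  _         = ℕP.n<1+n n′
  prev<n {suc k} (s≤s k<n′) = ℕP.m<n⇒m<1+n k<n′

  next<n : ∀ k → next k < n
  next<n k = m%n<n (suc k) n

  ≡next⇔prev≡ : ∀ {i j} → i < n → j < n → (j ≡ next i ⇔ i ≡ prev j)
  ≡next⇔prev≡ {i} {j} (s≤s i≤n′) j<n with ℕP.m≤n⇒m<n∨m≡n i≤n′
  ... | inj₁ i<n′ =
    subst (λ k → j ≡ k ⇔ i ≡ prev j) (sym (m<n⇒m%n≡m (s≤s i<n′))) (mk⇔ (λ { refl → refl }) (to j j<n))
    where
    to : ∀ j → j < n → i ≡ prev j → j ≡ suc i
    to zero    _          refl = ⊥-elim (ℕP.<-irrefl refl i<n′)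
    to (suc j) _          refl = refl
  ... | inj₂ refl =
    subst (λ k → j ≡ k ⇔ n′ ≡ prev j) (sym (n%n≡0 n)) (mk⇔ (λ { refl → refl }) (to j j<n))
    where
    to : ∀ j → j < n → n′ ≡ prev j → j ≡ 0
    to zero    _          _    = refl
    to (suc j) (s≤s j<n′) refl = ⊥-elim (ℕP.<-irrefl refl j<n′)

  M : Matrix n
  M = I ⊕ₘ A n

  open Image M public

  col : ℕ → Vector n
  col k = + 5 *ᵥ δ k -ᵥ δ (prev k) -ᵥ δ (next k)

  column-M : ∀ j i → column M j i ≡ col (toℕ j) i
  column-M j i = begin
    I i j + ((+ 4 * I i j - δ (next (toℕ i)) j) - δ (next (toℕ j)) i)
      ≡⟨ cong (λ t → I i j + ((+ 4 * I i j - t) - δ (next (toℕ j)) i))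
              (δ-⇔ (≡next⇔prev≡ (FinP.toℕ<n i) (FinP.toℕ<n j))) ⟩
    I i j + ((+ 4 * I i j - δ (prev (toℕ j)) i) - δ (next (toℕ j)) i)
      ≡⟨ five (I i j) _ _ ⟩
    + 5 * I i j - δ (prev (toℕ j)) i - δ (next (toℕ j)) i  ∎
    where
    five : ∀ x y w → x + ((+ 4 * x - y) - w) ≡ + 5 * x - y - w
    five = solve-∀

  col∈Im : ∀ {k} → k < n → col k ∈Im M
  col∈Im k<n = ∈Im-resp (λ i → trans (sym (cong (λ t → col t i) (FinP.toℕ-fromℕ< k<n))) (sym (column-M j i)))
                        (column∈Im j)
    where
    j : Fin n
    j = fromℕ< k<n

  Δ : (ℕ → ℤ) → ℕ → ℤ
  Δ φ k = + 5 * φ k - φ (prev k) - φ (next k)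

  ⟨col⟩ : ∀ (φ : ℕ → ℤ) {k} → k < n → ⟨ col k , φ ∘ toℕ ⟩ ≡ Δ φ k
  ⟨col⟩ φ {k} k<n = begin
    ⟨ + 5 *ᵥ δ k -ᵥ δ (prev k) -ᵥ δ (next k) , φ′ ⟩
      ≡⟨ ⟨x-ᵥy⟩ (+ 5 *ᵥ δ k -ᵥ δ (prev k)) (δ (next k)) φ′ ⟩
    ⟨ + 5 *ᵥ δ k -ᵥ δ (prev k) , φ′ ⟩ - ⟨ δ (next k) , φ′ ⟩
      ≡⟨ cong (_- ⟨ δ (next k) , φ′ ⟩) (⟨x-ᵥy⟩ (+ 5 *ᵥ δ k) (δ (prev k)) φ′) ⟩
    ⟨ + 5 *ᵥ δ k , φ′ ⟩ - ⟨ δ (prev k) , φ′ ⟩ - ⟨ δ (next k) , φ′ ⟩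
      ≡⟨ cong₂ (λ s t → s - t - ⟨ δ (next k) , φ′ ⟩) (⟨*ᵥ⟩ (+ 5) (δ k) φ′) (⟨δ⟩ (prev k) (prev<n k<n) φ) ⟩
    + 5 * ⟨ δ k , φ′ ⟩ - φ (prev k) - ⟨ δ (next k) , φ′ ⟩
      ≡⟨ cong₂ (λ s t → + 5 * s - φ (prev k) - t) (⟨δ⟩ k k<n φ) (⟨δ⟩ (next k) (next<n k) φ) ⟩
    Δ φ k ∎
    where
    φ′ : Vector n
    φ′ = φ ∘ toℕ

  Δ-interior : ∀ {φ} → Recurrent φ → ∀ {k} → suc (suc k) < n → Δ φ (suc k) ≡ 0ℤ
  Δ-interior {φ} rec {k} k+2<n = begin
    + 5 * φ (suc k) - φ k - φ (next (suc k)) ≡⟨ cong (λ t → + 5 * φ (suc k) - φ k - φ t) (m<n⇒m%n≡m k+2<n) ⟩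
    + 5 * φ (suc k) - φ k - φ (suc (suc k)) ≡⟨ cong (_-_ (+ 5 * φ (suc k) - φ k)) (rec k) ⟩
    + 5 * φ (suc k) - φ k - (+ 5 * φ (suc k) - φ k) ≡⟨ ℤP.+-inverseʳ (+ 5 * φ (suc k) - φ k) ⟩
    0ℤ ∎

  ∣Δ : ∀ {d} φ → Recurrent φ → d ∣ Δ φ 0 → d ∣ Δ φ n′ → ∀ {k} → k < n → d ∣ Δ φ k
  ∣Δ φ rec d∣first d∣last {zero}  _ = d∣first
  ∣Δ {d} φ rec d∣first d∣last {suc k} (s≤s k<n′) with ℕP.m≤n⇒m<n∨m≡n k<n′
  ... | inj₁ k+1<n′  = subst (d ∣_) (sym (Δ-interior {φ} rec (s≤s k+1<n′))) (∣0 d)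
  ... | inj₂ k+1≡n′ = subst (λ t → d ∣ Δ φ t) (sym k+1≡n′) d∣last

  ⟨M·⟩ : ∀ (φ : ℕ → ℤ) z → ⟨ M · z , φ ∘ toℕ ⟩ ≡ ∑ (λ j → z j * Δ φ (toℕ j))
  ⟨M·⟩ φ z = trans (⟨·⟩ M z (φ ∘ toℕ))
    (∑-cong (λ j → cong (z j *_) (trans (⟨⟩-cong (φ ∘ toℕ) (column-M j)) (⟨col⟩ φ (FinP.toℕ<n j)))))

  ∣⟨M·⟩ : ∀ {d} (φ : ℕ → ℤ) → (∀ {k} → k < n → d ∣ Δ φ k) → ∀ z → d ∣ ⟨ M · z , φ ∘ toℕ ⟩
  ∣⟨M·⟩ {d} φ d∣Δφ z = subst (d ∣_) (sym (⟨M·⟩ φ z))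
    (∣-∑ (λ j → z j * Δ φ (toℕ j)) (λ j → ∣n⇒∣m*n (z j) (d∣Δφ (FinP.toℕ<n j))))

module Reduction (m : ℕ) where

  open Cyclic (suc m) public

  ι : ℤ → ℤ → Vector n
  ι a b = a *ᵥ δ 0 +ᵥ b *ᵥ δ 1

  w₀′ u′ : Vector n
  w₀′ = w₀ ∘ toℕ
  u′ = u ∘ toℕ

  ⟨ι⟩ : ∀ a b (φ : ℕ → ℤ) → ⟨ ι a b , φ ∘ toℕ ⟩ ≡ a * φ 0 + b * φ 1
  ⟨ι⟩ a b φ = begin
    ⟨ a *ᵥ δ 0 +ᵥ b *ᵥ δ 1 , φ′ ⟩                ≡⟨ ⟨+ᵥ⟩ (a *ᵥ δ 0) (b *ᵥ δ 1) φ′ ⟩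
    ⟨ a *ᵥ δ 0 , φ′ ⟩ + ⟨ b *ᵥ δ 1 , φ′ ⟩          ≡⟨ cong₂ _+_ (⟨*ᵥ⟩ a (δ 0) φ′) (⟨*ᵥ⟩ b (δ 1) φ′) ⟩
    a * ⟨ δ 0 , φ′ ⟩ + b * ⟨ δ 1 , φ′ ⟩            ≡⟨ cong₂ (λ x y → a * x + b * y) (⟨δ⟩ {n} 0 (s≤s z≤n) φ)
                                                                                (⟨δ⟩ {n} 1 (s≤s (s≤s z≤n)) φ) ⟩
    a * φ 0 + b * φ 1                           ∎
    where
    φ′ : Vector n
    φ′ = φ ∘ toℕ

  R : ℕ → Vector n
  R k = δ k -ᵥ ι (w₀ k) (u k)

  R∈Im-pair : ∀ k → suc k < n → R k ∈Im M × R (suc k) ∈Im M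
  R∈Im-pair zero _ = ∈Im-resp (λ i → zero₀ (δ 0 i) (δ 1 i)) 0ᵥ∈Im , ∈Im-resp (λ i → zero₁ (δ 0 i) (δ 1 i)) 0ᵥ∈Im
    where
    zero₀ : ∀ x y → x + - (+ 1 * x + 0ℤ * y) ≡ 0ℤ
    zero₀ = solve-∀
    zero₁ : ∀ x y → y + - (0ℤ * x + + 1 * y) ≡ 0ℤ
    zero₁ = solve-∀
  R∈Im-pair (suc k) k+2<n =
    Rk+1 , ∈Im-resp step (∈Im-subᵥ (∈Im-subᵥ (∈Im-*ᵥ (+ 5) Rk+1) Rk) (col∈Im (ℕP.<-trans (ℕP.n<1+n _) k+2<n)))
    where
    Rk : R k ∈Im M
    Rk = proj₁ (R∈Im-pair k (ℕP.<-trans (ℕP.n<1+n _) k+2<n))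
    Rk+1 : R (suc k) ∈Im M
    Rk+1 = proj₂ (R∈Im-pair k (ℕP.<-trans (ℕP.n<1+n _) k+2<n))
    recurrence : ∀ x₀ x₁ x₂ y₀ y₁ a₀ a₁ b₀ b₁ →
      x₂ + - ((+ 5 * a₁ - a₀) * y₀ + (+ 5 * b₁ - b₀) * y₁) ≡
      + 5 * (x₁ + - (a₁ * y₀ + b₁ * y₁)) + - (x₀ + - (a₀ * y₀ + b₀ * y₁)) + - (+ 5 * x₁ + - x₀ + - x₂)
    recurrence = solve-∀
    step : ∀ i → R (suc (suc k)) i ≡ (+ 5 *ᵥ R (suc k) -ᵥ R k -ᵥ col (suc k)) i
    step i = trans
      (recurrence (δ k i) (δ (suc k) i) (δ (suc (suc k)) i) (δ 0 i) (δ 1 i) (w₀ k) (w₀ (suc k)) (u k) (u (suc k)))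
      (cong (λ t → + 5 * R (suc k) i + - R k i + - (+ 5 * δ (suc k) i + - δ k i + - δ t i))
            (sym (m<n⇒m%n≡m k+2<n)))

  R∈Im : ∀ {k} → k < n → R k ∈Im M
  R∈Im {zero}  _        = proj₁ (R∈Im-pair 0 (s≤s (s≤s z≤n)))
  R∈Im {suc k} k+1<n    = proj₂ (R∈Im-pair k k+1<n)

  reduce : ∀ x → (x -ᵥ ι ⟨ x , w₀′ ⟩ ⟨ x , u′ ⟩) ∈Im M
  reduce x = ∈Im-resp (λ i → sym (expand i)) (∈Im-combination x (λ k → R∈Im (FinP.toℕ<n k)))
    where
    distribute : ∀ c x a b y₀ y₁ → c * (x + - (a * y₀ + b * y₁)) ≡ c * x + ((c * a) * - y₀ + (c * b) * - y₁)
    distribute = solve-∀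
    collect : ∀ x a b y₀ y₁ → x + (a * - y₀ + b * - y₁) ≡ x + - (a * y₀ + b * y₁)
    collect = solve-∀
    expand : ∀ i → combination x (R ∘ toℕ) i ≡ (x -ᵥ ι ⟨ x , w₀′ ⟩ ⟨ x , u′ ⟩) i
    expand i = begin
      ∑ (λ k → x k * R (toℕ k) i)
        ≡⟨ ∑-cong (λ k → distribute (x k) (δ (toℕ k) i) (w₀′ k) (u′ k) (δ 0 i) (δ 1 i)) ⟩
      ∑ (λ k → x k * δ (toℕ k) i + (X k * - δ 0 i + Y k * - δ 1 i))
        ≡⟨ ∑-+ (λ k → x k * δ (toℕ k) i) (λ k → X k * - δ 0 i + Y k * - δ 1 i) ⟩
      ∑ (λ k → x k * δ (toℕ k) i) + ∑ (λ k → X k * - δ 0 i + Y k * - δ 1 i)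
        ≡⟨ cong₂ _+_ (∑-δ-expand x i) (∑-+ (λ k → X k * - δ 0 i) (λ k → Y k * - δ 1 i)) ⟩
      x i + (∑ (λ k → X k * - δ 0 i) + ∑ (λ k → Y k * - δ 1 i))
        ≡⟨ cong (_+_ (x i)) (cong₂ _+_ (∑-*ʳ (- δ 0 i) X) (∑-*ʳ (- δ 1 i) Y)) ⟩
      x i + (⟨ x , w₀′ ⟩ * - δ 0 i + ⟨ x , u′ ⟩ * - δ 1 i)
        ≡⟨ collect (x i) ⟨ x , w₀′ ⟩ ⟨ x , u′ ⟩ (δ 0 i) (δ 1 i) ⟩
      (x -ᵥ ι ⟨ x , w₀′ ⟩ ⟨ x , u′ ⟩) i ∎
      where
      X Y : Vector n
      X k = x k * w₀′ k
      Y k = x k * u′ k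

  relation∈Im : ∀ {k} → k < n → ι (Δ w₀ k) (Δ u k) ∈Im M
  relation∈Im {k} k<n = ∈Im-resp eq (∈Im-subᵥ (col∈Im k<n) (reduce (col k)))
    where
    cancel : ∀ c y → y ≡ c + - (c + - y)
    cancel = solve-∀
    eq : ∀ i → ι (Δ w₀ k) (Δ u k) i ≡ (col k -ᵥ (col k -ᵥ ι ⟨ col k , w₀′ ⟩ ⟨ col k , u′ ⟩)) i
    eq i = trans (cancel (col k i) _)
      (cong₂ (λ a b → col k i + - (col k i + - ι a b i)) (sym (⟨col⟩ w₀ k<n)) (sym (⟨col⟩ u k<n)))

  Δw₀-first : Δ w₀ 0 ≡ + 5 + u m
  Δw₀-first = begin
    + 5 * + 1 - w₀ (suc m) - 0ℤ  ≡⟨ cong (λ t → + 5 * + 1 - t - 0ℤ) (w₀-suc m) ⟩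
    + 5 * + 1 - - u m - 0ℤ       ≡⟨ simplify (u m) ⟩
    + 5 + u m                    ∎
    where
    simplify : ∀ x → + 5 * + 1 - - x - 0ℤ ≡ + 5 + x
    simplify = solve-∀

  Δu-first : Δ u 0 ≡ -[1+ 0 ] - u (suc m)
  Δu-first = simplify (u (suc m))
    where
    simplify : ∀ x → + 5 * 0ℤ - x - + 1 ≡ -[1+ 0 ] - x
    simplify = solve-∀

  Δw₀-last : Δ w₀ (suc m) ≡ -[1+ 0 ] - u (suc m)
  Δw₀-last = begin
    + 5 * w₀ (suc m) - w₀ m - w₀ (next (suc m))  ≡⟨ cong (λ t → + 5 * w₀ (suc m) - w₀ m - w₀ t) (n%n≡0 n) ⟩
    w₀ (suc (suc m)) - + 1                       ≡⟨ cong (_- + 1) (w₀-suc (suc m)) ⟩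
    - u (suc m) - + 1                            ≡⟨ simplify (u (suc m)) ⟩
    -[1+ 0 ] - u (suc m)                         ∎
    where
    simplify : ∀ x → - x - + 1 ≡ -[1+ 0 ] - x
    simplify = solve-∀

  Δu-last : Δ u (suc m) ≡ u (suc (suc m))
  Δu-last = begin
    + 5 * u (suc m) - u m - u (next (suc m))  ≡⟨ cong (λ t → + 5 * u (suc m) - u m - u t) (n%n≡0 n) ⟩
    u (suc (suc m)) - 0ℤ                      ≡⟨ ℤP.+-identityʳ _ ⟩
    u (suc (suc m))                           ∎

  ι-combination : ∀ c c′ a b a′ b′ i → ι (c * a + c′ * a′) (c * b + c′ * b′) i ≡ (c *ᵥ ι a b +ᵥ c′ *ᵥ ι a′ b′) i
  ι-combination c c′ a b a′ b′ i = bilinear c c′ a b a′ b′ (δ 0 i) (δ 1 i)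
    where
    bilinear : ∀ c c′ a b a′ b′ y₀ y₁ →
      (c * a + c′ * a′) * y₀ + (c * b + c′ * b′) * y₁ ≡ c * (a * y₀ + b * y₁) + c′ * (a′ * y₀ + b′ * y₁)
    bilinear = solve-∀

  -- In the coordinates (⟨-, w₀⟩, ⟨-, u⟩) the relations left after `reduce` are the two
  -- wrap-around columns; the hypotheses say they are the rows of d·[[p, q], [q, s]].
  coker-M≅ : ∀ (d k c α β p q s : ℤ) .{{_ : ℤ.NonZero k}} →
    + 5 + u m ≡ d * p → -[1+ 0 ] - u (suc m) ≡ d * q → u (suc (suc m)) ≡ d * s →
    p * s - q * q ≡ k → p + c * q ≡ k * α → q + c * s ≡ k * β →
    coker M ≅ (ℤ/ d ⊕ℤ/ (d * k))
  coker-M≅ d k c α β p q s first≡dp first≡dq last≡ds det kα kβ =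
    coker≅ℤ/⊕ℤ/ M u′ (ψ ∘ toℕ) Im⇒∣ onto ∣⇒Im
    where
    ψ : ℕ → ℤ
    ψ j = w₀ j + c * u j

    ψ-recurrent : Recurrent ψ
    ψ-recurrent k = combine (w₀ k) (w₀ (suc k)) (u k) (u (suc k)) c
      where
      combine : ∀ a₀ a₁ b₀ b₁ c → + 5 * a₁ - a₀ + c * (+ 5 * b₁ - b₀) ≡ + 5 * (a₁ + c * b₁) - (a₀ + c * b₀)
      combine = solve-∀

    Δψ : ∀ j → Δ ψ j ≡ Δ w₀ j + c * Δ u j
    Δψ j = combine (w₀ j) (w₀ (prev j)) (w₀ (next j)) (u j) (u (prev j)) (u (next j)) c
      where
      combine : ∀ a a⁻ a⁺ b b⁻ b⁺ c →
        + 5 * (a + c * b) - (a⁻ + c * b⁻) - (a⁺ + c * b⁺) ≡ + 5 * a - a⁻ - a⁺ + c * (+ 5 * b - b⁻ - b⁺)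
      combine = solve-∀

    d∣ : ∀ {a x} → a ≡ d * x → d ∣ a
    d∣ {a} {x} a≡dx = divides x (trans a≡dx (ℤP.*-comm d x))

    dk∣ : ∀ {a b x y γ} → a ≡ d * x → b ≡ d * y → x + c * y ≡ k * γ → (d * k) ∣ a + c * b
    dk∣ {a} {b} {x} {y} {γ} a≡dx b≡dy x+cy≡kγ = divides γ (begin
      a + c * b            ≡⟨ cong₂ (λ a b → a + c * b) a≡dx b≡dy ⟩
      d * x + c * (d * y)  ≡⟨ solve (c ∷ d ∷ x ∷ y ∷ []) ⟩
      d * (x + c * y)      ≡⟨ cong (d *_) x+cy≡kγ ⟩
      d * (k * γ)          ≡⟨ solve (d ∷ k ∷ γ ∷ []) ⟩
      γ * (d * k)          ∎)

    Im⇒∣ : ∀ z → d ∣ ⟨ M · z , u′ ⟩ × (d * k) ∣ ⟨ M · z , ψ ∘ toℕ ⟩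
    Im⇒∣ z =
      ∣⟨M·⟩ u (∣Δ u u-recurrent (d∣ (trans Δu-first first≡dq)) (d∣ (trans Δu-last last≡ds))) z ,
      ∣⟨M·⟩ ψ (∣Δ ψ ψ-recurrent
        (subst (d * k ∣_) (sym (Δψ 0)) (dk∣ (trans Δw₀-first first≡dp) (trans Δu-first first≡dq) kα))
        (subst (d * k ∣_) (sym (Δψ (suc m))) (dk∣ (trans Δw₀-last first≡dq) (trans Δu-last last≡ds) kβ))) z

    onto : ∀ a b → ∃ λ x → d ∣ ⟨ x , u′ ⟩ - a × (d * k) ∣ ⟨ x , ψ ∘ toℕ ⟩ - b
    onto a b = ι (b - c * a) a ,
      i≡j⇒d∣i-j d (trans (⟨ι⟩ (b - c * a) a u) (first-coordinate a b)) ,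
      i≡j⇒d∣i-j (d * k) (trans (⟨ι⟩ (b - c * a) a ψ) (second-coordinate a b c))
      where
      first-coordinate : ∀ a b → (b - c * a) * 0ℤ + a * + 1 ≡ a
      first-coordinate a b = solve (a ∷ b ∷ c ∷ [])
      second-coordinate : ∀ a b c → (b - c * a) * (+ 1 + c * 0ℤ) + a * (0ℤ + c * + 1) ≡ b
      second-coordinate = solve-∀

    ∣⇒Im : ∀ x → d ∣ ⟨ x , u′ ⟩ → (d * k) ∣ ⟨ x , ψ ∘ toℕ ⟩ → x ∈Im M
    ∣⇒Im x (divides t₁ Y≡t₁d) (divides t₂ ψ≡t₂dk) =
      ∈Im-resp (λ i → split (x i) (ι X Y i)) (∈Im-+ᵥ (reduce x) ιXY∈Im)
      where
      X Y : ℤ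
      X = ⟨ x , w₀′ ⟩
      Y = ⟨ x , u′ ⟩
      X+cY≡ : X + c * Y ≡ t₂ * (d * k)
      X+cY≡ = begin
        X + c * Y                      ≡⟨ cong₂ _+_ (⟨⟩-comm x w₀′) (cong (c *_) (⟨⟩-comm x u′)) ⟩
        ⟨ w₀′ , x ⟩ + c * ⟨ u′ , x ⟩    ≡⟨ cong (_+_ ⟨ w₀′ , x ⟩) (⟨*ᵥ⟩ c u′ x) ⟨
        ⟨ w₀′ , x ⟩ + ⟨ c *ᵥ u′ , x ⟩   ≡⟨ ⟨+ᵥ⟩ w₀′ (c *ᵥ u′) x ⟨
        ⟨ ψ ∘ toℕ , x ⟩                ≡⟨ ⟨⟩-comm (ψ ∘ toℕ) x ⟩
        ⟨ x , ψ ∘ toℕ ⟩                ≡⟨ ψ≡t₂dk ⟩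
        t₂ * (d * k)                   ∎
      relation₀ : ι (d * p) (d * q) ∈Im M
      relation₀ = subst₂ (λ a b → ι a b ∈Im M) (trans Δw₀-first first≡dp) (trans Δu-first first≡dq)
                         (relation∈Im (s≤s z≤n))
      relation₁ : ι (d * q) (d * s) ∈Im M
      relation₁ = subst₂ (λ a b → ι a b ∈Im M) (trans Δw₀-last first≡dq) (trans Δu-last last≡ds)
                         (relation∈Im (ℕP.n<1+n (suc m)))
      ιXY∈Im : ι X Y ∈Im M
      ιXY∈Im with span-of-rows {d} {k} {c} {α} {β} {p} {q} {s} det kα kβ {X} {Y} {t₁} {t₂} Y≡t₁d X+cY≡
      ... | c₀ , c₁ , X≡ , Y≡ =
        ∈Im-resp (λ i → trans (cong₂ (λ a b → ι a b i) X≡ Y≡)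
                              (ι-combination c₀ c₁ (d * p) (d * q) (d * q) (d * s) i))
                 (∈Im-+ᵥ (∈Im-*ᵥ c₀ relation₀) (∈Im-*ᵥ c₁ relation₁))
      split : ∀ x y → x ≡ (x + - y) + y
      split = solve-∀

u-double : ∀ j → u (j ℕ.* 2) ≡ u j * (+ 2 * u (suc j) - + 5 * u j)
               × u (suc (j ℕ.* 2)) ≡ u (suc j) * u (suc j) - u j * u j
u-double zero    = refl , refl
u-double (suc j) =
  trans (cong₂ (λ x y → + 5 * y - x) even odd) (step₀ (u j) (u (suc j))) ,
  trans (cong₂ (λ x y → + 5 * (+ 5 * y - x) - y) even odd) (step₁ (u j) (u (suc j)))
  where
  even = proj₁ (u-double j)
  odd  = proj₂ (u-double j)
  step₀ : ∀ a b → + 5 * (b * b - a * a) - a * (+ 2 * b - + 5 * a) ≡ b * (+ 2 * (+ 5 * b - a) - + 5 * b)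
  step₀ = solve-∀
  step₁ : ∀ a b → + 5 * (+ 5 * (b * b - a * a) - a * (+ 2 * b - + 5 * a)) - (b * b - a * a)
                ≡ (+ 5 * b - a) * (+ 5 * b - a) - b * b
  step₁ = solve-∀

cassini : ∀ j → u j * u j - + 5 * u j * u (suc j) + u (suc j) * u (suc j) ≡ + 1
cassini zero    = refl
cassini (suc j) = trans (shift (u j) (u (suc j))) (cassini j)
  where
  shift : ∀ a b → b * b - + 5 * b * (+ 5 * b - a) + (+ 5 * b - a) * (+ 5 * b - a) ≡ a * a - + 5 * a * b + b * b
  shift = solve-∀

mod-cassini : ∀ {a b L R} → a * a - + 5 * a * b + b * b ≡ + 1 →
              ∀ K → L ≡ R + K * (a * a - + 5 * a * b + b * b - + 1) → L ≡ R
mod-cassini {a} {b} {L} {R} cassini-ab K L≡ = begin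
  L                                            ≡⟨ L≡ ⟩
  R + K * (a * a - + 5 * a * b + b * b - + 1)  ≡⟨ cong (λ t → R + K * (t - + 1)) cassini-ab ⟩
  R + K * (+ 1 - + 1)                          ≡⟨ solve (R ∷ K ∷ []) ⟩
  R                                            ∎

ν-even : ∀ j → ν (j ℕ.* 2) ≡ u j
ν-even j rewrite m*n%n≡0 j 2 ⦃ _ ⦄ | m*n/n≡m j 2 ⦃ _ ⦄ = refl

μ-even : ∀ j → μ (j ℕ.* 2) ≡ 7
μ-even j rewrite m*n%n≡0 j 2 ⦃ _ ⦄ = refl

ν-odd : ∀ j → ν (suc (j ℕ.* 2)) ≡ u (suc j) + u j
ν-odd j rewrite [m+kn]%n≡m%n 1 j 2 ⦃ _ ⦄ =
  cong (λ k → u (suc k) + u k) (trans (+-distrib-/-∣ʳ 1 {d = 2} (ℕ∣.divides j refl)) (m*n/n≡m j 2))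

μ-odd : ∀ j → μ (suc (j ℕ.* 2)) ≡ 1
μ-odd j rewrite [m+kn]%n≡m%n 1 j 2 ⦃ _ ⦄ = refl

≅-relabel : ∀ {G d d′ e e′} → d ≡ d′ → e ≡ e′ → G ≅ (ℤ/ d ⊕ℤ/ e) → G ≅ (ℤ/ d′ ⊕ℤ/ e′)
≅-relabel refl refl G≅ = G≅

module EvenRelations (a b : ℤ) (cassini-ab : a * a - + 5 * a * b + b * b ≡ + 1) where

  first₀ : + 5 + a * (+ 2 * b - + 5 * a) ≡ b * (+ 5 * b - + 23 * a)
  first₀ = mod-cassini {a} {b} cassini-ab (- + 5) (solve (a ∷ b ∷ []))

  first₁ : -[1+ 0 ] - (b * b - a * a) ≡ b * (+ 5 * a - + 2 * b)
  first₁ = mod-cassini {a} {b} cassini-ab (+ 1) (solve (a ∷ b ∷ []))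

  last : + 5 * (b * b - a * a) - a * (+ 2 * b - + 5 * a) ≡ b * (+ 5 * b - + 2 * a)
  last = solve (a ∷ b ∷ [])

  det : (+ 5 * b - + 23 * a) * (+ 5 * b - + 2 * a) - (+ 5 * a - + 2 * b) * (+ 5 * a - + 2 * b) ≡ + 21
  det = mod-cassini {a} {b} cassini-ab (+ 21) (solve (a ∷ b ∷ []))

  kα : (+ 5 * b - + 23 * a) + + 13 * (+ 5 * a - + 2 * b) ≡ + 21 * (+ 2 * a - b)
  kα = solve (a ∷ b ∷ [])

  kβ : (+ 5 * a - + 2 * b) + + 13 * (+ 5 * b - + 2 * a) ≡ + 21 * (+ 3 * b - a)
  kβ = solve (a ∷ b ∷ [])

coker-even : ∀ j → let n = suc j ℕ.* 2 in coker (I ⊕ₘ A n) ≅ (ℤ/ ν n ⊕ℤ/ (+ 3 * + μ n * ν n))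
coker-even j = ≅-relabel (sym (ν-even (suc j)))
  (trans (three-times-seven b) (cong₂ (λ μ ν → + 3 * + μ * ν) (sym (μ-even (suc j))) (sym (ν-even (suc j)))))
  (coker-M≅ b (+ 21) (+ 13) (+ 2 * a - b) (+ 3 * b - a)
    (+ 5 * b - + 23 * a) (+ 5 * a - + 2 * b) (+ 5 * b - + 2 * a)
    (trans (cong (_+_ (+ 5)) (proj₁ (u-double j))) first₀)
    (trans (cong (_-_ -[1+ 0 ]) (proj₂ (u-double j))) first₁)
    (trans (cong₂ (λ x y → + 5 * y - x) (proj₁ (u-double j)) (proj₂ (u-double j))) last)
    det kα kβ)
  where
  open Reduction (j ℕ.* 2)
  a b : ℤ
  a = u j
  b = u (suc j)
  open EvenRelations a b (cassini j)
  three-times-seven : ∀ d → d * + 21 ≡ + 3 * + 7 * d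
  three-times-seven = solve-∀

module OddRelations (a b : ℤ) (cassini-ab : a * a - + 5 * a * b + b * b ≡ + 1) where

  first₀ : + 5 + (a * a - (+ 5 * a - b) * (+ 5 * a - b)) ≡ (b + a) * (+ 4 * b - + 19 * a)
  first₀ = mod-cassini {a} {b} cassini-ab (- + 5) (solve (a ∷ b ∷ []))

  first₁ : -[1+ 0 ] - a * (+ 2 * b - + 5 * a) ≡ (b + a) * (+ 4 * a - b)
  first₁ = mod-cassini {a} {b} cassini-ab (+ 1) (solve (a ∷ b ∷ []))

  last : b * b - a * a ≡ (b + a) * (b - a)
  last = solve (a ∷ b ∷ [])

  det : (+ 4 * b - + 19 * a) * (b - a) - (+ 4 * a - b) * (+ 4 * a - b) ≡ + 3
  det = mod-cassini {a} {b} cassini-ab (+ 3) (solve (a ∷ b ∷ []))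

  kα : (+ 4 * b - + 19 * a) + + 1 * (+ 4 * a - b) ≡ + 3 * (b - + 5 * a)
  kα = solve (a ∷ b ∷ [])

  kβ : (+ 4 * a - b) + + 1 * (b - a) ≡ + 3 * a
  kβ = solve (a ∷ b ∷ [])

coker-odd : ∀ j → let n = suc (suc j ℕ.* 2) in coker (I ⊕ₘ A n) ≅ (ℤ/ ν n ⊕ℤ/ (+ 3 * + μ n * ν n))
coker-odd j = ≅-relabel (sym (ν-odd (suc j)))
  (trans (three-times-one (b + a)) (cong₂ (λ μ ν → + 3 * + μ * ν) (sym (μ-odd (suc j))) (sym (ν-odd (suc j)))))
  (coker-M≅ (b + a) (+ 3) (+ 1) (b - + 5 * a) a
    (+ 4 * b - + 19 * a) (+ 4 * a - b) (b - a)
    (trans (cong (_+_ (+ 5)) (trans (proj₂ (u-double j)) (previous a (u j)))) first₀)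
    (trans (cong (_-_ -[1+ 0 ]) (proj₁ (u-double (suc j)))) first₁)
    (trans (proj₂ (u-double (suc j))) last)
    det kα kβ)
  where
  open Reduction (suc (j ℕ.* 2))
  a b : ℤ
  a = u (suc j)
  b = u (suc (suc j))
  open OddRelations a b (cassini (suc j))
  three-times-one : ∀ d → d * + 3 ≡ + 3 * + 1 * d
  three-times-one = solve-∀
  previous : ∀ x y → x * x - y * y ≡ x * x - (+ 5 * x - (+ 5 * x - y)) * (+ 5 * x - (+ 5 * x - y))
  previous = solve-∀

even-or-odd : ∀ m → (∃ λ j → m ≡ j ℕ.* 2) ⊎ (∃ λ j → m ≡ suc (j ℕ.* 2))
even-or-odd zero = inj₁ (0 , refl)
even-or-odd (suc m) with even-or-odd m
... | inj₁ (j , refl) = inj₂ (j , refl)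
... | inj₂ (j , refl) = inj₁ (suc j , refl)

proposition2 : (n : ℕ) → .{{_ : NonZero n}} →
    coker (I ⊕ₘ A n) ≅ (ℤ/ ν n ⊕ℤ/ (+ 3 * + μ n * ν n))
proposition2 (suc zero) = coker-n≡1
proposition2 (suc (suc m)) with even-or-odd m
... | inj₁ (j , refl) = coker-even j
... | inj₂ (j , refl) = coker-odd j
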